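{- Let $\sigma=(\sigma_1,\dots,\sigma_n)$ be a permutation of $\{1,\dots,n\}$ such that $\Gamma(P(\sigma))$ has exactly two rows, and let $1\le i\le n$ satisfy $\sigma_i=i$. Then $\sigma_j<i$ for all $1\le j<i$.
   Context: $P(\sigma)$ is the Robinson--Schensted--Knuth insertion tableau of $\sigma$ (insert $\sigma_1,\sigma_2,\dots$ in order by Schensted row insertion: to insert $a$ into row $r$, if the row is empty or $a$ exceeds all its entries append $a$ and stop, else replace the leftmost entry $b>a$ by $a$ and insert $b$ into row $r+1$), and $\Gamma(P(\sigma))$ is its shape (row lengths, nonincreasing). -}

module Defs where

open import Data.Nat using (ℕ; zero; suc; _<ᵇ_)
open import Data.Bool using (Bool; true; false; if_then_else_)
open import Data.List using (List; []; _∷_; _++_; map; foldl; length; upTo)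
open import Data.Maybe using (Maybe; just; nothing)
open import Data.Product using (_×_; _,_)

-- A tableau is a list of rows (top row first), each row a list of entries.
Tableau : Set
Tableau = List (List ℕ)

rowInsert : ℕ → List ℕ → List ℕ × Maybe ℕ
rowInsert a [] = (a ∷ [] , nothing)
rowInsert a (b ∷ bs) with a <ᵇ b
... | true  = (a ∷ bs , just b)
... | false with rowInsert a bs
...   | (bs' , m) = (b ∷ bs' , m)

insertT : ℕ → Tableau → Tableau
insertT a [] = (a ∷ []) ∷ []
insertT a (r ∷ rs) with rowInsert a r
... | (r' , nothing) = r' ∷ rs
... | (r' , just b)  = r' ∷ insertT b rs

P : List ℕ → Tableau
P σ = foldl (λ T a → insertT a T) [] σ

Γ : Tableau → List ℕ
Γ T = map length T

oneTo : ℕ → List ℕ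
oneTo n = map suc (upTo n)

module Submission where

-- Suppose σⱼ > i for some j < i. Since σᵢ = i, only i − 2 of the first i − 1 positions hold
-- values below i, so some value c < i occurs after position i, and σⱼ > i > c is a decreasing
-- subsequence of length three. Such a subsequence forces a third row: after inserting a and then
-- b < a, the entry b sits in the first row above a larger entry of the second row (or three rows
-- already exist), and inserting c < b then bumps an entry ≤ b out of the first row, which bumps
-- again out of the second.

open import Defs
open import Data.Nat using (ℕ; zero; suc; _<_; _≤_; _+_; _⊓_; z≤n; s≤s; _<ᵇ_; _≤?_; _<?_)
open import Data.Nat.Properties
open import Data.Bool using (true; false)
open import Data.List using (List; []; _∷_; _++_; length; lookup; take; drop; filter; map; upTo; foldl)
open import Data.List.Properties
  using ( foldl-++; length-map; length-++; length-++-≤ˡ; length-upTo; length-take; ++-assoc; map-++; upTo-∷ʳ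
        ; filter-++; filter-notAll; filter-none; filter-accept; filter-reject)
open import Data.List.Relation.Unary.Any as Any using (Any; here; there; any?)
open import Data.List.Relation.Unary.All.Properties using (¬Any⇒All¬)
open import Data.List.Relation.Unary.All as All using (All; []; _∷_)
open import Data.List.Relation.Unary.AllPairs using (AllPairs; []; _∷_)
open import Data.List.Relation.Unary.Unique.Propositional using (Unique)
open import Data.List.Relation.Unary.Unique.Propositional.Properties using (upTo⁺)
import Data.List.Relation.Unary.Unique.Propositional.Properties as Unique
open import Data.List.Membership.Propositional using (_∈_; _∉_; find; lose)
open import Data.List.Membership.Propositional.Properties using (∈-∃++; ∈-++⁺ʳ)
open import Data.List.Relation.Binary.Permutation.Propositional using (_↭_; ↭-sym; ↭⇒↭ₛ)
open import Data.List.Relation.Binary.Permutation.Propositional.Properties using (filter-↭; ↭-length)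
open import Data.List.Relation.Binary.Permutation.Setoid.Properties using (Unique-resp-↭)
open import Data.Fin using (Fin; toℕ; zero; suc)
open import Data.Fin.Properties using (toℕ<n)
open import Data.Maybe using (just; nothing)
open import Data.Product using (_×_; _,_; proj₁; proj₂; ∃)
open import Data.Sum using (_⊎_; inj₁; inj₂; [_,_]′)
open import Data.Empty using (⊥-elim)
open import Relation.Nullary using (yes; no)
open import Relation.Nullary.Reflects using (ofʸ; ofⁿ)
open import Relation.Binary.PropositionalEquality
  using (_≡_; refl; sym; trans; cong; subst; setoid; module ≡-Reasoning)

module _ (a : ℕ) where

  ∈-rowInsert : ∀ r → a ∈ proj₁ (rowInsert a r)
  ∈-rowInsert [] = here refl
  ∈-rowInsert (b ∷ bs) with a <ᵇ b
  ... | true = here refl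
  ... | false with rowInsert a bs | ∈-rowInsert bs
  ...   | _ | a∈ = there a∈

  rowInsert-keeps : ∀ {r x} → x ∈ r →
                    x ∈ proj₁ (rowInsert a r) ⊎ proj₂ (rowInsert a r) ≡ just x
  rowInsert-keeps {b ∷ bs} x∈ with a <ᵇ b
  rowInsert-keeps {b ∷ bs} (here refl) | true = inj₂ refl
  rowInsert-keeps {b ∷ bs} (there x∈) | true = inj₁ (there x∈)
  rowInsert-keeps {b ∷ bs} (here refl) | false with rowInsert a bs
  ... | _ = inj₁ (here refl)
  rowInsert-keeps {b ∷ bs} (there x∈) | false with rowInsert a bs | rowInsert-keeps x∈
  ... | _ | inj₁ x∈′ = inj₁ (there x∈′)
  ... | _ | inj₂ bumped = inj₂ bumped

  rowInsert-bumps : ∀ {r w} → w ∈ r → a < w → ∃ λ y → proj₂ (rowInsert a r) ≡ just y × a < y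
  rowInsert-bumps {b ∷ bs} w∈ a<w with a <ᵇ b | <ᵇ-reflects-< a b
  ... | true | ofʸ a<b = b , refl , a<b
  rowInsert-bumps {b ∷ bs} (here refl) a<w | false | ofⁿ a≮b = ⊥-elim (a≮b a<w)
  rowInsert-bumps {b ∷ bs} (there w∈) a<w | false | _ with rowInsert a bs | rowInsert-bumps w∈ a<w
  ... | _ | bump = bump

  rowInsert-bumps-≤ : ∀ {r w} → AllPairs _≤_ r → w ∈ r → a < w →
                      ∃ λ y → proj₂ (rowInsert a r) ≡ just y × y ≤ w
  rowInsert-bumps-≤ {b ∷ bs} (b≤ ∷ _) w∈ a<w with a <ᵇ b | <ᵇ-reflects-< a b
  rowInsert-bumps-≤ {b ∷ bs} (b≤ ∷ _) (here refl) a<w | true | _ = b , refl , ≤-refl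
  rowInsert-bumps-≤ {b ∷ bs} (b≤ ∷ _) (there w∈) a<w | true | _ =
    b , refl , All.lookup b≤ w∈
  rowInsert-bumps-≤ {b ∷ bs} _ (here refl) a<w | false | ofⁿ a≮b = ⊥-elim (a≮b a<w)
  rowInsert-bumps-≤ {b ∷ bs} (_ ∷ sorted) (there w∈) a<w | false | _
    with rowInsert a bs | rowInsert-bumps-≤ sorted w∈ a<w
  ... | _ | bump = bump

  rowInsert-All : ∀ {Q : ℕ → Set} {r} → All Q r → Q a → All Q (proj₁ (rowInsert a r))
  rowInsert-All [] Qa = Qa ∷ []
  rowInsert-All {r = b ∷ bs} (Qb ∷ Qbs) Qa with a <ᵇ b
  ... | true = Qa ∷ Qbs
  ... | false with rowInsert a bs | rowInsert-All Qbs Qa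
  ...   | _ | Qbs′ = Qb ∷ Qbs′

  rowInsert-sorted : ∀ {r} → AllPairs _≤_ r → AllPairs _≤_ (proj₁ (rowInsert a r))
  rowInsert-sorted [] = [] ∷ []
  rowInsert-sorted {b ∷ bs} (b≤ ∷ sorted) with a <ᵇ b | <ᵇ-reflects-< a b
  ... | true | ofʸ a<b = All.map (≤-trans (<⇒≤ a<b)) b≤ ∷ sorted
  ... | false | ofⁿ a≮b
    with rowInsert a bs | rowInsert-All b≤ (≮⇒≥ a≮b) | rowInsert-sorted sorted
  ...   | _ | b≤′ | sorted′ = b≤′ ∷ sorted′

row₁ : Tableau → List ℕ
row₁ [] = []
row₁ (r ∷ _) = r

row₂ : Tableau → List ℕ
row₂ [] = []
row₂ (_ ∷ rs) = row₁ rs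

_∈ₜ_ : ℕ → Tableau → Set
x ∈ₜ T = Any (x ∈_) T

insertT-nonempty : ∀ x T → 1 ≤ length (insertT x T)
insertT-nonempty x [] = s≤s z≤n
insertT-nonempty x (r ∷ rs) with rowInsert x r
... | _ , nothing = s≤s z≤n
... | _ , just _ = s≤s z≤n

insertT-length-mono : ∀ x T → length T ≤ length (insertT x T)
insertT-length-mono x [] = z≤n
insertT-length-mono x (r ∷ rs) with rowInsert x r
... | _ , nothing = ≤-refl
... | _ , just y = s≤s (insertT-length-mono y rs)

three-rows-insertT : ∀ x T → 3 ≤ length T → 3 ≤ length (insertT x T)
three-rows-insertT x T three = ≤-trans three (insertT-length-mono x T)

∈-row₁-insertT : ∀ x T → x ∈ row₁ (insertT x T)
∈-row₁-insertT x [] = here refl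
∈-row₁-insertT x (r ∷ rs) with rowInsert x r | ∈-rowInsert x r
... | _ , nothing | x∈ = x∈
... | _ , just _ | x∈ = x∈

row₁-sorted-insertT : ∀ x T → AllPairs _≤_ (row₁ T) → AllPairs _≤_ (row₁ (insertT x T))
row₁-sorted-insertT x [] _ = [] ∷ []
row₁-sorted-insertT x (r ∷ rs) sorted with rowInsert x r | rowInsert-sorted x sorted
... | _ , nothing | sorted′ = sorted′
... | _ , just _ | sorted′ = sorted′

∈ₜ-insertT : ∀ x T → x ∈ₜ insertT x T
∈ₜ-insertT x [] = here (here refl)
∈ₜ-insertT x (r ∷ rs) with rowInsert x r | ∈-rowInsert x r
... | _ , nothing | x∈ = here x∈
... | _ , just _ | x∈ = here x∈

∈ₜ-insertT⁺ : ∀ {y} x T → y ∈ₜ T → y ∈ₜ insertT x T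
∈ₜ-insertT⁺ x (r ∷ rs) (here y∈r) with rowInsert x r | rowInsert-keeps x y∈r
... | _ , nothing | inj₁ y∈ = here y∈
... | _ , just _ | inj₁ y∈ = here y∈
... | _ , just y | inj₂ refl = there (∈ₜ-insertT y rs)
∈ₜ-insertT⁺ x (r ∷ rs) (there y∈rs) with rowInsert x r
... | _ , nothing = there y∈rs
... | _ , just z = there (∈ₜ-insertT⁺ z rs y∈rs)

insertT-bumps-grows : ∀ x T {w} → w ∈ row₁ T → x < w → 2 ≤ length (insertT x T)
insertT-bumps-grows x (r ∷ rs) w∈ x<w with rowInsert x r | rowInsert-bumps x w∈ x<w
... | _ , nothing | _ , () , _
... | _ , just y | _ = s≤s (insertT-nonempty y rs)

insertT-bumps-into-row₂ : ∀ x T {w} → w ∈ row₁ T → x < w →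
                          ∃ λ y → y ∈ row₂ (insertT x T) × x < y
insertT-bumps-into-row₂ x (r ∷ rs) w∈ x<w with rowInsert x r | rowInsert-bumps x w∈ x<w
... | _ , nothing | _ , () , _
... | _ , just y | _ , refl , x<y = y , ∈-row₁-insertT y rs , x<y

∈-row₁-insertT⁺ : ∀ x T {w} → w ∈ row₁ T →
                  w ∈ row₁ (insertT x T) ⊎ 2 ≤ length (insertT x T)
∈-row₁-insertT⁺ x (r ∷ rs) w∈ with rowInsert x r | rowInsert-keeps x w∈
... | _ , nothing | inj₁ w∈′ = inj₁ w∈′
... | _ , nothing | inj₂ ()
... | _ , just y | _ = inj₂ (s≤s (insertT-nonempty y rs))

∈-row₂-insertT⁺ : ∀ x T {w} → w ∈ row₂ T →
                  w ∈ row₂ (insertT x T) ⊎ 3 ≤ length (insertT x T)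
∈-row₂-insertT⁺ x (r ∷ rs) w∈ with rowInsert x r
... | _ , nothing = inj₁ w∈
... | _ , just y with ∈-row₁-insertT⁺ y rs w∈
...   | inj₁ w∈′ = inj₁ w∈′
...   | inj₂ two = inj₂ (s≤s two)

-- Decreasing subsequences force rows

LargerBelow : ℕ → Tableau → Set
LargerBelow b T = b ∈ row₁ T × ∃ λ w → w ∈ row₂ T × b < w

largerBelow-insertT : ∀ {a} b T → a ∈ₜ T → b < a →
                      LargerBelow b (insertT b T) ⊎ 3 ≤ length (insertT b T)
largerBelow-insertT b T@(_ ∷ _) (here a∈) b<a with insertT-bumps-into-row₂ b T a∈ b<a
... | y , y∈ , b<y = inj₁ (∈-row₁-insertT b T , y , y∈ , b<y)
largerBelow-insertT b T@(_ ∷ _) (there (here a∈)) b<a with ∈-row₂-insertT⁺ b T a∈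
... | inj₁ a∈′ = inj₁ (∈-row₁-insertT b T , _ , a∈′ , b<a)
... | inj₂ three = inj₂ three
largerBelow-insertT b T@(_ ∷ _ ∷ _ ∷ _) (there (there _)) _ =
  inj₂ (three-rows-insertT b T (s≤s (s≤s (s≤s z≤n))))

largerBelow-insertT⁺ : ∀ {b} x T → LargerBelow b T →
                       LargerBelow b (insertT x T) ⊎ 3 ≤ length (insertT x T)
largerBelow-insertT⁺ x T@(r ∷ rs) (b∈ , w , w∈ , b<w) with ∈-row₂-insertT⁺ x T w∈
... | inj₂ three = inj₂ three
... | inj₁ w∈′ with rowInsert x r | rowInsert-keeps x b∈
...   | _ , nothing | inj₁ b∈′ = inj₁ (b∈′ , w , w∈′ , b<w)
...   | _ , just _ | inj₁ b∈′ = inj₁ (b∈′ , w , w∈′ , b<w)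
...   | _ , just b | inj₂ refl = inj₂ (s≤s (insertT-bumps-grows b rs w∈ b<w))

largerBelow⇒three-rows : ∀ {b} c T → AllPairs _≤_ (row₁ T) → LargerBelow b T → c < b →
                         3 ≤ length (insertT c T)
largerBelow⇒three-rows c (r ∷ rs) sorted (b∈ , w , w∈ , b<w) c<b
  with rowInsert c r | rowInsert-bumps-≤ c sorted b∈ c<b
... | _ , nothing | _ , () , _
... | _ , just y | _ , refl , y≤b = s≤s (insertT-bumps-grows y rs w∈ (≤-<-trans y≤b b<w))

insertAll : Tableau → List ℕ → Tableau
insertAll = foldl (λ T a → insertT a T)

insertAll-++ : ∀ T xs ys → insertAll T (xs ++ ys) ≡ insertAll (insertAll T xs) ys
insertAll-++ = foldl-++ (λ T a → insertT a T)

insertAll-preserves : ∀ {Q : Tableau → Set} → (∀ x T → Q T → Q (insertT x T)) →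
                      ∀ T xs → Q T → Q (insertAll T xs)
insertAll-preserves step T [] Q-T = Q-T
insertAll-preserves step T (x ∷ xs) Q-T = insertAll-preserves step (insertT x T) xs (step x T Q-T)

or-three-rows : ∀ {Q : Tableau → Set} →
                (∀ x T → Q T → Q (insertT x T) ⊎ 3 ≤ length (insertT x T)) →
                ∀ x T → Q T ⊎ 3 ≤ length T → Q (insertT x T) ⊎ 3 ≤ length (insertT x T)
or-three-rows step x T (inj₁ Q-T) = step x T Q-T
or-three-rows step x T (inj₂ three) = inj₂ (three-rows-insertT x T three)

row₁-sorted-insertAll : ∀ T xs → AllPairs _≤_ (row₁ T) → AllPairs _≤_ (row₁ (insertAll T xs))
row₁-sorted-insertAll = insertAll-preserves row₁-sorted-insertT

three-rows-insertAll : ∀ T xs → 3 ≤ length T → 3 ≤ length (insertAll T xs)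
three-rows-insertAll = insertAll-preserves three-rows-insertT

decreasing-triple⇒three-rows : ∀ {a b c} xs ys zs ws → b < a → c < b →
                               3 ≤ length (P (xs ++ a ∷ ys ++ b ∷ zs ++ c ∷ ws))
decreasing-triple⇒three-rows {a} {b} {c} xs ys zs ws b<a c<b =
  subst (λ T → 3 ≤ length T) (sym P≡)
        (three-rows-insertAll (insertT c T₂) ws ([ c-over-b , three-rows-insertT c T₂ ]′ b-over-a))
  where
  open ≡-Reasoning
  T₀ = P xs
  T₁ = insertAll (insertT a T₀) ys
  T₂ = insertAll (insertT b T₁) zs

  P≡ : P (xs ++ a ∷ ys ++ b ∷ zs ++ c ∷ ws) ≡ insertAll (insertT c T₂) ws
  P≡ = begin
    P (xs ++ a ∷ ys ++ b ∷ zs ++ c ∷ ws)              ≡⟨ insertAll-++ [] xs _ ⟩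
    insertAll (insertT a T₀) (ys ++ b ∷ zs ++ c ∷ ws) ≡⟨ insertAll-++ (insertT a T₀) ys _ ⟩
    insertAll (insertT b T₁) (zs ++ c ∷ ws)           ≡⟨ insertAll-++ (insertT b T₁) zs _ ⟩
    insertAll (insertT c T₂) ws                       ∎

  b-over-a : LargerBelow b T₂ ⊎ 3 ≤ length T₂
  b-over-a = insertAll-preserves (or-three-rows largerBelow-insertT⁺) (insertT b T₁) zs
    (largerBelow-insertT b T₁ (insertAll-preserves ∈ₜ-insertT⁺ (insertT a T₀) ys (∈ₜ-insertT a T₀)) b<a)

  sorted-after : ∀ x T xs → AllPairs _≤_ (row₁ T) →
                 AllPairs _≤_ (row₁ (insertAll (insertT x T) xs))
  sorted-after x T xs sorted = row₁-sorted-insertAll (insertT x T) xs (row₁-sorted-insertT x T sorted)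

  c-over-b : LargerBelow b T₂ → 3 ≤ length (insertT c T₂)
  c-over-b below = largerBelow⇒three-rows c T₂ sorted₂ below c<b
    where sorted₂ = sorted-after b T₁ zs (sorted-after a T₀ ys (row₁-sorted-insertAll [] xs []))

count≤ : ℕ → List ℕ → ℕ
count≤ t xs = length (filter (_≤? t) xs)

count≤-++ : ∀ t xs ys → count≤ t (xs ++ ys) ≡ count≤ t xs + count≤ t ys
count≤-++ t xs ys = trans (cong length (filter-++ (_≤? t) xs ys)) (length-++ (filter (_≤? t) xs))

oneTo-suc : ∀ n → oneTo (suc n) ≡ oneTo n ++ suc n ∷ []
oneTo-suc n = trans (cong (map suc) (sym (upTo-∷ʳ n))) (map-++ suc (upTo n) (n ∷ []))

length-oneTo : ∀ n → length (oneTo n) ≡ n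
length-oneTo n = trans (length-map suc (upTo n)) (length-upTo n)

count≤-oneTo : ∀ t n → count≤ t (oneTo n) ≡ t ⊓ n
count≤-oneTo t zero = sym (⊓-zeroʳ t)
count≤-oneTo t (suc n) = begin
  count≤ t (oneTo (suc n))                   ≡⟨ cong (count≤ t) (oneTo-suc n) ⟩
  count≤ t (oneTo n ++ suc n ∷ [])           ≡⟨ count≤-++ t (oneTo n) (suc n ∷ []) ⟩
  count≤ t (oneTo n) + count≤ t (suc n ∷ []) ≡⟨ cong (_+ count≤ t (suc n ∷ [])) (count≤-oneTo t n) ⟩
  t ⊓ n + count≤ t (suc n ∷ [])              ≡⟨ last ⟩
  t ⊓ suc n                                  ∎
  where
  open ≡-Reasoning
  last : t ⊓ n + count≤ t (suc n ∷ []) ≡ t ⊓ suc n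
  last with suc n ≤? t
  ... | yes n<t = begin
    t ⊓ n + count≤ t (suc n ∷ []) ≡⟨ cong (λ xs → t ⊓ n + length xs) (filter-accept (_≤? t) n<t) ⟩
    t ⊓ n + 1                     ≡⟨ cong (_+ 1) (m≥n⇒m⊓n≡n (<⇒≤ n<t)) ⟩
    n + 1                         ≡⟨ +-comm n 1 ⟩
    suc n                         ≡⟨ sym (m≥n⇒m⊓n≡n n<t) ⟩
    t ⊓ suc n                     ∎
  ... | no n≮t = begin
    t ⊓ n + count≤ t (suc n ∷ []) ≡⟨ cong (λ xs → t ⊓ n + length xs) (filter-reject (_≤? t) n≮t) ⟩
    t ⊓ n + 0                     ≡⟨ +-identityʳ (t ⊓ n) ⟩
    t ⊓ n                         ≡⟨ m≤n⇒m⊓n≡m t≤n ⟩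
    t                             ≡⟨ sym (m≤n⇒m⊓n≡m (m≤n⇒m≤1+n t≤n)) ⟩
    t ⊓ suc n                     ∎
    where t≤n = ≮⇒≥ n≮t

-- The entries ≤ length p of p ++ s are exactly 1, …, length p, and one slot of p is taken
-- by a larger entry.
large-in-prefix⇒small-in-suffix : ∀ {n} p s → p ++ s ↭ oneTo n → Any (length p <_) p →
                                  Any (_≤ length p) s
large-in-prefix⇒small-in-suffix {n} p s perm large with any? (_≤? length p) s
... | yes small = small
... | no none = ⊥-elim (<-irrefl refl (begin-strict
  k                        ≡⟨ sym (m≤n⇒m⊓n≡m k≤n) ⟩
  k ⊓ n                    ≡⟨ sym (count≤-oneTo k n) ⟩
  count≤ k (oneTo n)       ≡⟨ sym (↭-length (filter-↭ (_≤? k) perm)) ⟩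
  count≤ k (p ++ s)        ≡⟨ count≤-++ k p s ⟩
  count≤ k p + count≤ k s  ≡⟨ cong (λ xs → count≤ k p + length xs)
                                   (filter-none (_≤? k) (¬Any⇒All¬ s none)) ⟩
  count≤ k p + 0           ≡⟨ +-identityʳ (count≤ k p) ⟩
  count≤ k p               <⟨ filter-notAll (_≤? k) p (Any.map <⇒≱ large) ⟩
  length p                 ∎))
  where
  open ≤-Reasoning
  k = length p
  k≤n : k ≤ n
  k≤n = subst (k ≤_) (trans (↭-length perm) (length-oneTo n)) (length-++-≤ˡ p)

↭-oneTo⇒Unique : ∀ {n σ} → σ ↭ oneTo n → Unique σ
↭-oneTo⇒Unique {n} perm =
  Unique-resp-↭ (setoid ℕ) (↭⇒↭ₛ (↭-sym perm)) (Unique.map⁺ suc-injective (upTo⁺ n))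

Unique-++-∷⇒∉ : ∀ {A : Set} {x : A} xs {ys} → Unique (xs ++ x ∷ ys) → x ∉ xs
Unique-++-∷⇒∉ (y ∷ xs) (y∉ ∷ _) (here refl) = All.lookup y∉ (∈-++⁺ʳ xs (here refl)) refl
Unique-++-∷⇒∉ (y ∷ xs) (_ ∷ unique) (there x∈) = Unique-++-∷⇒∉ xs unique x∈

fixed-point-after-larger⇒three-rows : ∀ {n k v} p s → length p ≡ k → p ++ suc k ∷ s ↭ oneTo n →
                                      v ∈ p → k < v → 3 ≤ length (P (p ++ suc k ∷ s))
fixed-point-after-larger⇒three-rows {v = v} p s refl perm v∈p k<v
  with large-in-prefix⇒small-in-suffix p (suc (length p) ∷ s) perm (lose v∈p k<v)
... | here k+1≤k = ⊥-elim (1+n≰n k+1≤k)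
... | there c≤k∈s with find c≤k∈s | ∈-∃++ v∈p
...   | c , c∈s , c≤k | p₁ , p₂ , refl with ∈-∃++ c∈s
...     | s₁ , s₂ , refl =
  subst (λ τ → 3 ≤ length (P τ)) (sym (++-assoc p₁ (v ∷ p₂) (suc k ∷ s₁ ++ c ∷ s₂)))
        (decreasing-triple⇒three-rows p₁ p₂ s₁ s₂ k+1<v (s≤s c≤k))
  where
  k = length (p₁ ++ v ∷ p₂)
  k+1∉p : suc k ∉ p₁ ++ v ∷ p₂
  k+1∉p = Unique-++-∷⇒∉ (p₁ ++ v ∷ p₂) (↭-oneTo⇒Unique perm)
  k+1<v : suc k < v
  k+1<v = ≤∧≢⇒< k<v (λ k+1≡v → k+1∉p (subst (_∈ p₁ ++ v ∷ p₂) (sym k+1≡v) v∈p))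

module _ {A : Set} where

  take-lookup-drop : ∀ (xs : List A) i →
                     xs ≡ take (toℕ i) xs ++ lookup xs i ∷ drop (suc (toℕ i)) xs
  take-lookup-drop (x ∷ xs) zero = refl
  take-lookup-drop (x ∷ xs) (suc i) = cong (x ∷_) (take-lookup-drop xs i)

  length-take-toℕ : ∀ (xs : List A) (i : Fin (length xs)) → length (take (toℕ i) xs) ≡ toℕ i
  length-take-toℕ xs i = trans (length-take (toℕ i) xs) (m≤n⇒m⊓n≡m (<⇒≤ (toℕ<n i)))

  lookup∈take : ∀ (xs : List A) {i j : Fin (length xs)} → toℕ j < toℕ i →
                lookup xs j ∈ take (toℕ i) xs
  lookup∈take (x ∷ xs) {suc i} {zero} _ = here refl
  lookup∈take (x ∷ xs) {suc i} {suc j} (s≤s j<i) = there (lookup∈take xs j<i)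

lemma5p4 : (n : ℕ) (σ : List ℕ) → σ ↭ oneTo n → length (Γ (P σ)) ≡ 2 →
    (i : Fin (length σ)) → lookup σ i ≡ suc (toℕ i) →
    (j : Fin (length σ)) → toℕ j < toℕ i → lookup σ j < suc (toℕ i)
lemma5p4 n σ perm two-rows i σᵢ≡i+1 j j<i with lookup σ j <? suc (toℕ i)
... | yes σⱼ≤i = σⱼ≤i
... | no σⱼ≰i = ⊥-elim (1+n≰n (subst (3 ≤_) rows≡2 three-rows))
  where
  k = toℕ i
  rows≡2 : length (P σ) ≡ 2
  rows≡2 = trans (sym (length-map length (P σ))) two-rows
  σ≡ : σ ≡ take k σ ++ suc k ∷ drop (suc k) σ
  σ≡ = subst (λ x → σ ≡ take k σ ++ x ∷ drop (suc k) σ) σᵢ≡i+1 (take-lookup-drop σ i)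
  three-rows : 3 ≤ length (P σ)
  three-rows = subst (λ τ → 3 ≤ length (P τ)) (sym σ≡)
    (fixed-point-after-larger⇒three-rows (take k σ) (drop (suc k) σ) (length-take-toℕ σ i)
      (subst (_↭ oneTo n) σ≡ perm) (lookup∈take σ j<i) (≮⇒≥ σⱼ≰i))
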